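{- There is no norm-perfect Eisenstein prime, i.e. no prime $\psi\in\mathbb{Z}[\omega]$ satisfies $N(\sigma(\psi))=3N(\psi)$.
   Context: $\omega=e^{2\pi i/3}$, $N(a+b\omega)=a^2-ab+b^2$. Positive primes: $\{a+b\omega: a>b\ge 0\}\cap\{\text{primes of }\mathbb{Z}[\omega]\}$; each prime has exactly one positive associate. For nonzero $\alpha=\varepsilon\prod\pi_j^{e_j}$ ($\varepsilon$ a unit, distinct positive primes $\pi_j$), $\sigma(\alpha)=\prod\frac{\pi_j^{e_j+1}-1}{\pi_j-1}$; in particular $\sigma(\psi)=\pi+1$ where $\pi$ is the positive associate of the prime $\psi$. -}

module Defs where

open import Data.Integer using (ℤ; +_; _+_; _*_; _-_; -_; _<_; _≤_)
open import Data.Product using (Σ; ∃; _×_; _,_)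
open import Data.Sum using (_⊎_)
open import Relation.Binary.PropositionalEquality using (_≡_)
open import Relation.Nullary using (¬_)

-- Eisenstein integers a + b ω, with ω = e^{2πi/3}, ω² = -1 - ω.
record 𝔼 : Set where
  constructor _+_ω
  field
    re : ℤ
    im : ℤ
open 𝔼 public

0𝔼 : 𝔼
0𝔼 = (+ 0) + (+ 0) ω

1𝔼 : 𝔼
1𝔼 = (+ 1) + (+ 0) ω

infixl 6 _⊕_
infixl 7 _⊗_

_⊕_ : 𝔼 → 𝔼 → 𝔼
(a + b ω) ⊕ (c + d ω) = (a + c) + (b + d) ω

_⊗_ : 𝔼 → 𝔼 → 𝔼
(a + b ω) ⊗ (c + d ω) = (a * c - b * d) + (a * d + b * c - b * d) ω

N : 𝔼 → ℤ
N (a + b ω) = a * a - a * b + b * b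

_∣𝔼_ : 𝔼 → 𝔼 → Set
α ∣𝔼 β = Σ 𝔼 λ γ → β ≡ α ⊗ γ

IsUnit : 𝔼 → Set
IsUnit u = Σ 𝔼 λ v → u ⊗ v ≡ 1𝔼

IsPrime : 𝔼 → Set
IsPrime p = ¬ (p ≡ 0𝔼) × ¬ IsUnit p
          × (∀ α β → p ∣𝔼 (α ⊗ β) → p ∣𝔼 α ⊎ p ∣𝔼 β)

Associated : 𝔼 → 𝔼 → Set
Associated α β = Σ 𝔼 λ u → IsUnit u × α ≡ u ⊗ β

IsPositive : 𝔼 → Set
IsPositive (a + b ω) = b < a × + 0 ≤ b

-- σ(ψ) = π + 1, π the positive associate of ψ

-- Associates have the same norm, so it suffices to treat the positive
-- associate π = a + bω, written a = 1 + b + t with b, t ∈ ℕ.  Then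
--   3 N(π) − N(π + 1) = b (1 + 2b) + 2at − 1,
-- and b (1 + 2b) + 2at is never 1: it vanishes for π = 1 and is at least 2
-- otherwise.
module Submission where

open import Defs
open import Data.Integer using (+_; -[1+_]; _+_; _-_; _*_; +≤+; +<+)
open import Data.Integer.Properties using (pos-*; +-injective; +-inverseʳ; *-identityˡ; i-j≡0⇒i≡j)
open import Data.Integer.Tactic.RingSolver using (solve-∀)
import Data.Nat as ℕ
open ℕ using (ℕ; zero; suc)
open import Data.Nat.Properties using (m*n≡1⇒m≡1; m≤n⇒∃[o]m+o≡n)
open import Data.Product using (∃; ∃₂; _,_)
open import Relation.Binary.PropositionalEquality
  using (_≡_; _≢_; refl; sym; trans; cong; cong₂; module ≡-Reasoning)
open import Relation.Nullary using (¬_)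

N-⊗ : ∀ α β → N (α ⊗ β) ≡ N α * N β
N-⊗ (a + b ω) (c + d ω) = identity a b c d
  where
  identity : ∀ a b c d →
    (a * c - b * d) * (a * c - b * d) - (a * c - b * d) * (a * d + b * c - b * d)
      + (a * d + b * c - b * d) * (a * d + b * c - b * d)
    ≡ (a * a - a * b + b * b) * (c * c - c * d + d * d)
  identity = solve-∀

square-nonneg : ∀ x → ∃ λ k → x * x ≡ + k
square-nonneg (+ n)    = n ℕ.* n , sym (pos-* n n)
square-nonneg -[1+ n ] = suc n ℕ.* suc n , refl

four-N : ∀ a b → + 4 * (a * a - a * b + b * b) ≡ (+ 2 * a - b) * (+ 2 * a - b) + + 3 * (b * b)
four-N = solve-∀

N-nonneg : ∀ α → ∃ λ k → N α ≡ + k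
N-nonneg (a + b ω) with N (a + b ω) | four-N a b
... | + k      | _  = k , refl
... | -[1+ _ ] | eq with square-nonneg (+ 2 * a - b) | square-nonneg b
...   | k , k≡ | l , l≡ rewrite k≡ | l≡ | sym (pos-* 3 l) with eq
...     | ()

N-unit : ∀ u → IsUnit u → N u ≡ + 1
N-unit u (v , uv≡1) with N-nonneg u | N-nonneg v
... | k , Nu≡k | l , Nv≡l = trans Nu≡k (cong +_ (m*n≡1⇒m≡1 k l (+-injective kl≡1)))
  where
  open ≡-Reasoning
  kl≡1 : + (k ℕ.* l) ≡ + 1
  kl≡1 = begin
    + (k ℕ.* l)  ≡⟨ pos-* k l ⟩
    + k * + l    ≡⟨ sym (cong₂ _*_ Nu≡k Nv≡l) ⟩
    N u * N v    ≡⟨ sym (N-⊗ u v) ⟩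
    N (u ⊗ v)    ≡⟨ cong N uv≡1 ⟩
    + 1          ∎

N-associated : ∀ {α β} → Associated α β → N α ≡ N β
N-associated {α} {β} (u , u-unit , α≡uβ) = begin
  N α          ≡⟨ cong N α≡uβ ⟩
  N (u ⊗ β)    ≡⟨ N-⊗ u β ⟩
  N u * N β    ≡⟨ cong (_* N β) (N-unit u u-unit) ⟩
  + 1 * N β    ≡⟨ *-identityˡ (N β) ⟩
  N β          ∎
  where open ≡-Reasoning

positive-form : ∀ {π} → IsPositive π → ∃₂ λ b t → π ≡ (+ suc (b ℕ.+ t)) + (+ b) ω
positive-form {_ + _ ω} (+<+ {b} b<a , +≤+ _) with m≤n⇒∃[o]m+o≡n b<a
... | t , refl = b , t , refl

perfectDefect : ℕ → ℕ → ℕ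
perfectDefect b t = b ℕ.* (1 ℕ.+ 2 ℕ.* b) ℕ.+ t ℕ.* (2 ℕ.* suc (b ℕ.+ t))

perfectDefect≢1 : ∀ b t → perfectDefect b t ≢ 1
perfectDefect≢1 zero    zero    ()
perfectDefect≢1 zero    (suc t) ()
perfectDefect≢1 (suc b) t       ()

three-N-minus-N-suc : ∀ b t →
  let π = (+ suc (b ℕ.+ t)) + (+ b) ω in
  + 3 * N π - N (π ⊕ 1𝔼) ≡ + perfectDefect b t - + 1
three-N-minus-N-suc b t = trans (identity (+ b) (+ t)) (cong (_- + 1) (sym defect-ℤ))
  where
  identity : ∀ B T → let A = + 1 + (B + T) in
    + 3 * (A * A - A * B + B * B) - ((A + + 1) * (A + + 1) - (A + + 1) * (B + + 0) + (B + + 0) * (B + + 0))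
    ≡ (B * (+ 1 + + 2 * B) + T * (+ 2 * A)) - + 1
  identity = solve-∀
  defect-ℤ : + perfectDefect b t ≡ + b * (+ 1 + + 2 * + b) + + t * (+ 2 * + suc (b ℕ.+ t))
  defect-ℤ = cong₂ _+_
    (trans (pos-* b _) (cong (λ x → + b * (+ 1 + x)) (pos-* 2 b)))
    (trans (pos-* t _) (cong (+ t *_) (pos-* 2 (suc (b ℕ.+ t)))))

positive-not-norm-perfect : ∀ b t → let π = (+ suc (b ℕ.+ t)) + (+ b) ω in
  N (π ⊕ 1𝔼) ≢ + 3 * N π
positive-not-norm-perfect b t perfect = perfectDefect≢1 b t (+-injective defect≡1)
  where
  π = (+ suc (b ℕ.+ t)) + (+ b) ω
  defect≡1 : + perfectDefect b t ≡ + 1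
  defect≡1 = i-j≡0⇒i≡j _ _ (begin
    + perfectDefect b t - + 1   ≡⟨ sym (three-N-minus-N-suc b t) ⟩
    + 3 * N π - N (π ⊕ 1𝔼)     ≡⟨ cong (+ 3 * N π -_) perfect ⟩
    + 3 * N π - + 3 * N π      ≡⟨ +-inverseʳ (+ 3 * N π) ⟩
    + 0                        ∎)
    where open ≡-Reasoning

mainTheorem13 : (ψ π : 𝔼) → IsPrime ψ → IsPositive π → Associated ψ π →
    ¬ (N (π ⊕ 1𝔼) ≡ (+ 3) * N ψ)
mainTheorem13 ψ π _ π-positive ψ~π perfect with positive-form π-positive
... | b , t , refl = positive-not-norm-perfect b t (trans perfect (cong (+ 3 *_) (N-associated ψ~π)))
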